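{- Let $H=(V,E)$ be a hypergraph with at least 3 edges, and $L=\mathcal{L}(H)$ its intersection graph. (1) If $H$ is eulerian, then $L$ has a Hamilton cycle. (2) If $H$ is quasi-eulerian, then $L$ has a spanning subgraph whose connected components are 1-regular or 2-regular. (3) If $H$ has an Euler family containing no closed strict trail of length less than 3, then $L$ has a 2-factor.
   Context: A hypergraph $H=(V,E)$ has a nonempty finite vertex set $V$ and a finite set $E$ of edges, each associated with a subset of $V$ (parallel edges allowed); hypergraphs are assumed to have no empty edges. The intersection graph $\mathcal{L}(H)$ has vertex set $E$ and an edge $ee'$ for every pair of distinct edges $e\neq e'$ with $e\cap e'\neq\emptyset$. A walk of length $k$ is $v_0e_1v_1\dots e_kv_k$ with $v_{i-1}\ne v_i$ and $v_{i-1},v_i\in e_i$; anchors $v_0,\dots,v_k$; closed if $k\ge2$ and $v_0=v_k$; a strict trail if $e_1,\dots,e_k$ are pairwise distinct. An Euler tour is a closed strict trail traversing every edge; $H$ is eulerian if it has one. An Euler family is a family of pairwise anchor-disjoint closed strict trails such that each edge lies in exactly one of them; $H$ is quasi-eulerian if it has one. -}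

module Defs where

open import Data.Nat using (ℕ; zero; suc; _≤_)
open import Data.Fin using (Fin; toℕ; inject₁; fromℕ) renaming (zero to fzero; suc to fsuc)
open import Data.Fin.Subset using (Subset; _∈_)
open import Data.Bool using (Bool; true; false; if_then_else_)
open import Data.List using (List; map)
open import Data.Nat.ListAction using (sum)
open import Data.List using () renaming (allFin to allFinL)
open import Data.Product using (Σ; ∃; ∃-syntax; _×_; _,_)
open import Data.Sum using (_⊎_)
open import Relation.Nullary using (¬_)
open import Relation.Binary.PropositionalEquality using (_≡_; _≢_)
open import Function.Definitions using (Injective)

-- Hypergraphs: vertices Fin nV (nonempty), edges Fin nE (parallel edges
-- allowed, since distinct edge names may carry the same vertex subset),
-- each edge a nonempty subset of the vertices.

record Hypergraph : Set where
  field
    nV        : ℕ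
    nE        : ℕ
    V-nonempty : 1 ≤ nV
    edgeSet   : Fin nE → Subset nV
    edge-nonempty : ∀ e → ∃[ v ] (v ∈ edgeSet e)
open Hypergraph public

record Graph : Set₁ where
  field
    n   : ℕ
    Adj : Fin n → Fin n → Set
open Graph public

L : Hypergraph → Graph
L H = record
  { n   = nE H
  ; Adj = λ e e' → (e ≢ e') × ∃[ v ] (v ∈ edgeSet H e × v ∈ edgeSet H e')
  }

-- Walks v₀ e₁ v₁ … e_k v_k  (anchors indexed by Fin (suc k), edges by Fin k;
-- edge i joins anchor (inject₁ i) and anchor (fsuc i)).

record Walk (H : Hypergraph) : Set where
  field
    len    : ℕ
    anchor : Fin (suc len) → Fin (nV H)
    edgeOf : Fin len → Fin (nE H)
    step-distinct : ∀ i → anchor (inject₁ i) ≢ anchor (fsuc i)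
    step-incident : ∀ i → (anchor (inject₁ i) ∈ edgeSet H (edgeOf i))
                        × (anchor (fsuc i) ∈ edgeSet H (edgeOf i))
open Walk public

IsClosed : ∀ {H} → Walk H → Set
IsClosed W = (2 ≤ len W) × (anchor W fzero ≡ anchor W (fromℕ (len W)))

IsStrictTrail : ∀ {H} → Walk H → Set
IsStrictTrail W = Injective _≡_ _≡_ (edgeOf W)

Traverses : ∀ {H} → Walk H → Fin (nE H) → Set
Traverses W e = ∃[ i ] (edgeOf W i ≡ e)

IsEulerTour : ∀ {H} → Walk H → Set
IsEulerTour {H} W = IsClosed W × IsStrictTrail W × (∀ e → Traverses W e)

IsEulerian : Hypergraph → Set
IsEulerian H = ∃[ W ] (IsEulerTour {H} W)

record EulerFamily (H : Hypergraph) : Set where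
  field
    size   : ℕ
    trail  : Fin size → Walk H
    closed : ∀ j → IsClosed (trail j)
    strict : ∀ j → IsStrictTrail (trail j)
    anchor-disjoint : ∀ j j' → j ≢ j' → ∀ a a' →
                      anchor (trail j) a ≢ anchor (trail j') a'
    covers : ∀ e → ∃[ j ] Traverses (trail j) e
    unique : ∀ e j j' → Traverses (trail j) e → Traverses (trail j') e → j ≡ j'
open EulerFamily public

IsQuasiEulerian : Hypergraph → Set
IsQuasiEulerian H = EulerFamily H

CyclicSucc : ∀ {m} → Fin m → Fin m → Set
CyclicSucc {m} i j = (suc (toℕ i) ≡ toℕ j) ⊎ ((suc (toℕ i) ≡ m) × (toℕ j ≡ 0))

HamiltonCycle : Graph → Set
HamiltonCycle G =
  (3 ≤ n G) × Σ (Fin (n G) → Fin (n G)) λ σ → (Injective _≡_ _≡_ σ ×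
                     (∀ i j → CyclicSucc {n G} i j → Adj G (σ i) (σ j)))

record SpanningSubgraph (G : Graph) : Set where
  field
    sel     : Fin (n G) → Fin (n G) → Bool
    sel-sym : ∀ x y → sel x y ≡ sel y x
    sel-adj : ∀ x y → sel x y ≡ true → Adj G x y
open SpanningSubgraph public

degree : ∀ {G} → SpanningSubgraph G → Fin (n G) → ℕ
degree {G} S x = sum (map (λ y → if sel S x y then 1 else 0) (allFinL (n G)))

data Reach {G : Graph} (S : SpanningSubgraph G) : Fin (n G) → Fin (n G) → Set where
  here : ∀ {x} → Reach S x x
  step : ∀ {x y z} → sel S x y ≡ true → Reach S y z → Reach S x z

ComponentsRegular12 : ∀ {G} → SpanningSubgraph G → Set
ComponentsRegular12 S =
  ∀ x → (∀ y → Reach S x y → degree S y ≡ 1)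
      ⊎ (∀ y → Reach S x y → degree S y ≡ 2)

TwoFactor : Graph → Set
TwoFactor G = Σ (SpanningSubgraph G) λ S → ∀ x → degree S x ≡ 2

-- Consecutive edges of a closed strict trail share an anchor, hence are adjacent in
-- L(H) (and distinct, the trail being strict of length at least 2). An Euler tour
-- lists every edge exactly once, so its cyclic edge sequence is a Hamilton cycle of
-- L(H). Given an Euler family, join every edge to its cyclic successor and
-- predecessor on the unique trail containing it: on a trail of length 2 the two
-- coincide and the trail spans a copy of K₂, on a longer trail they differ and the
-- trail spans a cycle.

module Submission where

open import Defs
open import Data.Nat using (ℕ; zero; suc; _≤_; _+_; _<?_; s≤s)
open import Data.Nat.Properties
  using (≤-antisym; suc-injective; ≮⇒≥; 0≢1+n; 1+n≢n; m≢1+n+m; <-irrefl; ≤∧≢⇒<)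
  renaming (_≟_ to _≟ℕ_)
open import Data.Fin using (Fin; toℕ; inject₁; fromℕ; fromℕ<) renaming (zero to fzero; suc to fsuc)
open import Data.Fin.Properties
  using (_≟_; toℕ-injective; toℕ-inject₁; toℕ-fromℕ; toℕ-fromℕ<; toℕ<n; cantor-schröder-bernstein)
open import Data.Fin.Subset using (_∈_)
open import Data.Bool using (Bool; true; false; if_then_else_; _∨_)
open import Data.Bool.Properties using (∨-comm; ∨-identityʳ; ∨-idem)
open import Data.List using (map; allFin)
open import Data.List.Properties using (map-tabulate; map-cong)
open import Data.Nat.ListAction using (sum)
open import Data.Product using (Σ; _×_; _,_; proj₁; proj₂; map₂)
open import Data.Sum using (_⊎_; inj₁; inj₂)
open import Data.Empty using (⊥-elim)
open import Function using (_∘_; id)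
open import Function.Bundles using (_⇔_; mk⇔)
open import Function.Definitions using (Injective)
open import Relation.Nullary using (¬_; yes; no)
open import Relation.Nullary.Decidable using (does; does-⇔)
open import Relation.Binary.PropositionalEquality

next : ∀ {k} → Fin k → Fin k
next {suc m} i with suc (toℕ i) <? suc m
... | yes i+1<k = fromℕ< i+1<k
... | no _      = fzero

next-cyclicSucc : ∀ {k} (i : Fin k) → CyclicSucc i (next i)
next-cyclicSucc {suc m} i with suc (toℕ i) <? suc m
... | yes i+1<k = inj₁ (sym (toℕ-fromℕ< i+1<k))
... | no i+1≮k  = inj₂ (≤-antisym (toℕ<n i) (≮⇒≥ i+1≮k) , refl)

prev : ∀ {k} → Fin k → Fin k
prev {suc m} fzero = fromℕ m
prev (fsuc i)      = inject₁ i

prev-cyclicSucc : ∀ {k} (i : Fin k) → CyclicSucc (prev i) i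
prev-cyclicSucc {suc m} fzero = inj₂ (cong suc (toℕ-fromℕ m) , refl)
prev-cyclicSucc (fsuc i)      = inj₁ (cong suc (toℕ-inject₁ i))

module _ {k : ℕ} where

  CyclicSucc-functional : ∀ {i j j' : Fin k} → CyclicSucc i j → CyclicSucc i j' → j ≡ j'
  CyclicSucc-functional (inj₁ p)       (inj₁ q)       = toℕ-injective (trans (sym p) q)
  CyclicSucc-functional (inj₂ (_ , p)) (inj₂ (_ , q)) = toℕ-injective (trans p (sym q))
  CyclicSucc-functional {j = j} (inj₁ p) (inj₂ (q , _)) = ⊥-elim (<-irrefl (trans (sym p) q) (toℕ<n j))
  CyclicSucc-functional {j' = j'} (inj₂ (p , _)) (inj₁ q) = ⊥-elim (<-irrefl (trans (sym q) p) (toℕ<n j'))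

  CyclicSucc-injective : ∀ {i i' j : Fin k} → CyclicSucc i j → CyclicSucc i' j → i ≡ i'
  CyclicSucc-injective (inj₁ p)       (inj₁ q)       = toℕ-injective (suc-injective (trans p (sym q)))
  CyclicSucc-injective (inj₂ (p , _)) (inj₂ (q , _)) = toℕ-injective (suc-injective (trans p (sym q)))
  CyclicSucc-injective (inj₁ p)       (inj₂ (_ , q)) = ⊥-elim (0≢1+n (trans (sym q) (sym p)))
  CyclicSucc-injective (inj₂ (_ , p)) (inj₁ q)       = ⊥-elim (0≢1+n (trans (sym p) (sym q)))

  CyclicSucc-irrefl : 2 ≤ k → ∀ {i : Fin k} → ¬ CyclicSucc i i
  CyclicSucc-irrefl _   (inj₁ p)         = 1+n≢n p
  CyclicSucc-irrefl 2≤k (inj₂ (p , i≡0)) with subst (2 ≤_) (trans (sym p) (cong suc i≡0)) 2≤k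
  ... | s≤s ()

  CyclicSucc-asym : 3 ≤ k → ∀ {i j : Fin k} → CyclicSucc i j → ¬ CyclicSucc j i
  CyclicSucc-asym 3≤k cs sc = asym cs sc 3≤k
    where
    asym : ∀ {k m n} → (suc m ≡ n) ⊎ ((suc m ≡ k) × (n ≡ 0)) →
           (suc n ≡ m) ⊎ ((suc n ≡ k) × (m ≡ 0)) → ¬ (3 ≤ k)
    asym (inj₁ refl)          (inj₁ q)             _              = m≢1+n+m _ (sym q)
    asym (inj₁ refl)          (inj₂ (refl , refl)) (s≤s (s≤s ()))
    asym (inj₂ (refl , refl)) (inj₁ refl)          (s≤s (s≤s ()))
    asym (inj₂ (refl , refl)) (inj₂ (_ , refl))    (s≤s ())

  prev-next : ∀ (i : Fin k) → prev (next i) ≡ i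
  prev-next i = CyclicSucc-injective (prev-cyclicSucc (next i)) (next-cyclicSucc i)

  next-prev : ∀ (i : Fin k) → next (prev i) ≡ i
  next-prev i = CyclicSucc-functional (next-cyclicSucc (prev i)) (prev-cyclicSucc i)

next≡prev : ∀ {k} → k ≡ 2 → ∀ (i : Fin k) → next i ≡ prev i
next≡prev refl fzero        = refl
next≡prev refl (fsuc fzero) = refl

Adj-sym : ∀ {H x y} → Adj (L H) x y → Adj (L H) y x
Adj-sym (x≢y , v , v∈x , v∈y) = (x≢y ∘ sym) , v , v∈y , v∈x

module _ {H : Hypergraph} (W : Walk H) (cl : IsClosed W) where

  closed-sharedAnchor : ∀ {i j} → CyclicSucc i j → anchor W (fsuc i) ≡ anchor W (inject₁ j)
  closed-sharedAnchor {j = j} (inj₁ p) =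
    cong (anchor W) (toℕ-injective (trans p (sym (toℕ-inject₁ j))))
  closed-sharedAnchor {i} {j} (inj₂ (p , j≡0)) = begin
    anchor W (fsuc i)           ≡⟨ cong (anchor W) (toℕ-injective (trans p (sym (toℕ-fromℕ (len W))))) ⟩
    anchor W (fromℕ (len W))    ≡⟨ sym (proj₂ cl) ⟩
    anchor W fzero              ≡⟨ cong (anchor W) (toℕ-injective (sym (trans (toℕ-inject₁ j) j≡0))) ⟩
    anchor W (inject₁ j)        ∎
    where open ≡-Reasoning

  consecutive-adjacent : IsStrictTrail W → ∀ {i j} → CyclicSucc i j →
                         Adj (L H) (edgeOf W i) (edgeOf W j)
  consecutive-adjacent st {i} {j} cs =
      (λ eᵢ≡eⱼ → CyclicSucc-irrefl (proj₁ cl) (subst (CyclicSucc i) (sym (st eᵢ≡eⱼ)) cs))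
    , anchor W (fsuc i)
    , proj₂ (step-incident W i)
    , subst (_∈ edgeSet H (edgeOf W j)) (sym (closed-sharedAnchor cs)) (proj₁ (step-incident W j))

eulerTour-length : ∀ {H} {W : Walk H} → IsEulerTour W → len W ≡ nE H
eulerTour-length {W = W} (_ , st , traverses) = cantor-schröder-bernstein st position-injective
  where
  position-injective : Injective _≡_ _≡_ (proj₁ ∘ traverses)
  position-injective {e} {e'} p =
    trans (sym (proj₂ (traverses e))) (trans (cong (edgeOf W) p) (proj₂ (traverses e')))

hamiltonCycle : ∀ G {m} (σ : Fin m → Fin (n G)) → m ≡ n G → 3 ≤ n G → Injective _≡_ _≡_ σ →
                (∀ i j → CyclicSucc i j → Adj G (σ i) (σ j)) → HamiltonCycle G
hamiltonCycle G σ refl 3≤n σ-injective σ-adj = 3≤n , σ , σ-injective , σ-adj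

eulerian⇒hamiltonian : ∀ {H} → 3 ≤ nE H → IsEulerian H → HamiltonCycle (L H)
eulerian⇒hamiltonian {H} 3≤n (W , tour@(cl , st , _)) =
  hamiltonCycle (L H) (edgeOf W) (eulerTour-length {W = W} tour) 3≤n st
    (λ _ _ → consecutive-adjacent W cl st)

count : ∀ {n} → (Fin n → Bool) → ℕ
count {n} p = sum (map (λ y → if p y then 1 else 0) (allFin n))

count-suc : ∀ {n} (p : Fin (suc n) → Bool) → count p ≡ (if p fzero then 1 else 0) + count (p ∘ fsuc)
count-suc p = cong ((if p fzero then 1 else 0) +_) (cong sum
  (trans (map-tabulate fsuc (λ y → if p y then 1 else 0))
         (sym (map-tabulate id (λ y → if p (fsuc y) then 1 else 0)))))

count-cong : ∀ {n} {p q : Fin n → Bool} → (∀ y → p y ≡ q y) → count p ≡ count q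
count-cong {n} p≗q = cong sum (map-cong (λ y → cong (if_then 1 else 0) (p≗q y)) (allFin n))

count-false : ∀ n → count {n} (λ _ → false) ≡ 0
count-false zero    = refl
count-false (suc n) = trans (count-suc {n} (λ _ → false)) (count-false n)

-- Using does rather than ⌊_⌋ lets does (fsuc y ≟ fsuc a) reduce to does (y ≟ a).
count-singleton : ∀ {n} (a : Fin n) → count (λ y → does (y ≟ a)) ≡ 1
count-singleton {suc n} a = trans (count-suc (λ y → does (y ≟ a))) (go a)
  where
  go : ∀ (a : Fin (suc n)) →
       (if does (fzero ≟ a) then 1 else 0) + count (λ y → does (fsuc y ≟ a)) ≡ 1
  go fzero    = cong suc (count-false n)
  go (fsuc a) = count-singleton a

isOneOf : ∀ {n} → Fin n → Fin n → Fin n → Bool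
isOneOf a b y = does (y ≟ a) ∨ does (y ≟ b)

count-isOneOf-≡ : ∀ {n} {a b : Fin n} → a ≡ b → count (isOneOf a b) ≡ 1
count-isOneOf-≡ {a = a} refl = trans (count-cong (λ y → ∨-idem (does (y ≟ a)))) (count-singleton a)

count-isOneOf-≢ : ∀ {n} {a b : Fin n} → a ≢ b → count (isOneOf a b) ≡ 2
count-isOneOf-≢ {suc n} {a} {b} a≢b = trans (count-suc (isOneOf a b)) (go a b a≢b)
  where
  go : ∀ (a b : Fin (suc n)) → a ≢ b →
       (if isOneOf a b fzero then 1 else 0) + count (isOneOf a b ∘ fsuc) ≡ 2
  go fzero    fzero    a≢b = ⊥-elim (a≢b refl)
  go fzero    (fsuc b) _   = cong suc (count-singleton b)
  go (fsuc a) fzero    _   =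
    cong suc (trans (count-cong (λ y → ∨-identityʳ (does (y ≟ a)))) (count-singleton a))
  go (fsuc a) (fsuc b) a≢b = count-isOneOf-≢ (a≢b ∘ cong fsuc)

module TrailNeighbours {H : Hypergraph} (F : EulerFamily H) where

  Position : Set
  Position = Σ (Fin (size F)) λ j → Fin (len (trail F j))

  edgeAt : Position → Fin (nE H)
  edgeAt (j , i) = edgeOf (trail F j) i

  edgeAt-injective : Injective _≡_ _≡_ edgeAt
  edgeAt-injective {j , i} {j' , i'} e with unique F _ j j' (i , e) (i' , refl)
  ... | refl = cong (j ,_) (strict F j e)

  position : Fin (nE H) → Position
  position x = proj₁ (covers F x) , proj₁ (proj₂ (covers F x))

  edgeAt-position : ∀ x → edgeAt (position x) ≡ x
  edgeAt-position x = proj₂ (proj₂ (covers F x))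

  position-edgeAt : ∀ p → position (edgeAt p) ≡ p
  position-edgeAt p = edgeAt-injective (edgeAt-position (edgeAt p))

  trailOf : Fin (nE H) → Fin (size F)
  trailOf = proj₁ ∘ position

  succ pred : Fin (nE H) → Fin (nE H)
  succ = edgeAt ∘ map₂ next ∘ position
  pred = edgeAt ∘ map₂ prev ∘ position

  pred-succ : ∀ x → pred (succ x) ≡ x
  pred-succ x = begin
    pred (succ x)                               ≡⟨ cong (edgeAt ∘ map₂ prev) (position-edgeAt _) ⟩
    edgeAt (map₂ (prev ∘ next) (position x))    ≡⟨ cong (λ i → edgeAt (trailOf x , i)) (prev-next _) ⟩
    edgeAt (position x)                         ≡⟨ edgeAt-position x ⟩
    x                                           ∎
    where open ≡-Reasoning

  succ-pred : ∀ x → succ (pred x) ≡ x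
  succ-pred x = begin
    succ (pred x)                               ≡⟨ cong (edgeAt ∘ map₂ next) (position-edgeAt _) ⟩
    edgeAt (map₂ (next ∘ prev) (position x))    ≡⟨ cong (λ i → edgeAt (trailOf x , i)) (next-prev _) ⟩
    edgeAt (position x)                         ≡⟨ edgeAt-position x ⟩
    x                                           ∎
    where open ≡-Reasoning

  ≡succ⇔≡pred : ∀ x y → x ≡ succ y ⇔ y ≡ pred x
  ≡succ⇔≡pred x y = mk⇔ (λ x≡sy → trans (sym (pred-succ y)) (cong pred (sym x≡sy)))
                         (λ y≡px → trans (sym (succ-pred x)) (cong succ (sym y≡px)))

  trailOf-succ : ∀ x → trailOf (succ x) ≡ trailOf x
  trailOf-succ x = cong proj₁ (position-edgeAt _)

  adjacent-succ : ∀ x → Adj (L H) x (succ x)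
  adjacent-succ x = subst (λ z → Adj (L H) z (succ x)) (edgeAt-position x)
    (consecutive-adjacent (trail F j) (closed F j) (strict F j) (next-cyclicSucc _))
    where j = trailOf x

  trailLength : Fin (nE H) → ℕ
  trailLength x = len (trail F (trailOf x))

  succ≢pred : ∀ x → 3 ≤ trailLength x → succ x ≢ pred x
  succ≢pred x 3≤l sx≡px = CyclicSucc-asym 3≤l (next-cyclicSucc i)
    (subst (λ j → CyclicSucc j i) (sym (strict F (trailOf x) sx≡px)) (prev-cyclicSucc i))
    where i = proj₂ (position x)

  succ≡pred : ∀ x → trailLength x ≡ 2 → succ x ≡ pred x
  succ≡pred x l≡2 = cong (edgeOf (trail F (trailOf x))) (next≡prev l≡2 _)

  -- Joining x and y when one is the trail-successor of the other is symmetric by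
  -- construction; as succ and pred are inverse, the neighbours of x are succ x and pred x.
  linked : Fin (nE H) → Fin (nE H) → Bool
  linked x y = does (y ≟ succ x) ∨ does (x ≟ succ y)

  linked-true : ∀ x y → linked x y ≡ true → y ≡ succ x ⊎ x ≡ succ y
  linked-true x y _ with y ≟ succ x | x ≟ succ y
  ... | yes y≡sx | _        = inj₁ y≡sx
  ... | no _     | yes x≡sy = inj₂ x≡sy
  linked-true _ _ () | no _ | no _

  linked-adjacent : ∀ x y → linked x y ≡ true → Adj (L H) x y
  linked-adjacent x y xy with linked-true x y xy
  ... | inj₁ refl = adjacent-succ x
  ... | inj₂ refl = Adj-sym {H} (adjacent-succ y)

  linked-trailOf : ∀ x y → linked x y ≡ true → trailOf y ≡ trailOf x
  linked-trailOf x y xy with linked-true x y xy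
  ... | inj₁ refl = trailOf-succ x
  ... | inj₂ refl = sym (trailOf-succ y)

  neighbours : SpanningSubgraph (L H)
  neighbours = record
    { sel     = linked
    ; sel-sym = λ x y → ∨-comm (does (y ≟ succ x)) (does (x ≟ succ y))
    ; sel-adj = linked-adjacent
    }

  degree-neighbours : ∀ x → degree neighbours x ≡ count (isOneOf (succ x) (pred x))
  degree-neighbours x = count-cong λ y →
    cong (does (y ≟ succ x) ∨_) (does-⇔ (≡succ⇔≡pred x y) (x ≟ succ y) (y ≟ pred x))

  degree-neighbours-2 : ∀ x → 3 ≤ trailLength x → degree neighbours x ≡ 2
  degree-neighbours-2 x 3≤l = trans (degree-neighbours x) (count-isOneOf-≢ (succ≢pred x 3≤l))

  degree-neighbours-1 : ∀ x → trailLength x ≡ 2 → degree neighbours x ≡ 1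
  degree-neighbours-1 x l≡2 = trans (degree-neighbours x) (count-isOneOf-≡ (succ≡pred x l≡2))

  reach-trailOf : ∀ {x y} → Reach neighbours x y → trailOf y ≡ trailOf x
  reach-trailOf here                 = refl
  reach-trailOf (step {x} {y} xy yz) = trans (reach-trailOf yz) (linked-trailOf x y xy)

  neighbours-componentsRegular12 : ComponentsRegular12 neighbours
  neighbours-componentsRegular12 x with trailLength x ≟ℕ 2
  ... | yes l≡2 = inj₁ λ y x↝y →
    degree-neighbours-1 y (trans (cong (len ∘ trail F) (reach-trailOf x↝y)) l≡2)
  ... | no l≢2  = inj₂ λ y x↝y →
    degree-neighbours-2 y (subst (3 ≤_) (cong (len ∘ trail F) (sym (reach-trailOf x↝y)))
                                 (≤∧≢⇒< (proj₁ (closed F (trailOf x))) (l≢2 ∘ sym)))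

mainTheorem6 : (H : Hypergraph) → 3 ≤ nE H →
    (IsEulerian H → HamiltonCycle (L H))
    × (IsQuasiEulerian H → Σ (SpanningSubgraph (L H)) ComponentsRegular12)
    × ((F : EulerFamily H) → (∀ (j : Fin (size F)) → 3 ≤ len (trail F j)) →
    TwoFactor (L H))
mainTheorem6 H 3≤n =
    eulerian⇒hamiltonian 3≤n
  , (λ F → neighbours F , neighbours-componentsRegular12 F)
  , (λ F long → neighbours F , λ x → degree-neighbours-2 F x (long (trailOf F x)))
  where open TrailNeighbours
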